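{- There exists an opfibration from $\mathcal{G}_T$ to the Schreier graph $LN\text{ - }\mathcal{S}(\Sigma_T)$; in particular, since $\mathcal{G}_T$ is finite, $\Sigma_T$ has finite index in $\Pi$.
   Context: Let $\Pi=\mathrm{PGL}_2\mathbb{Z}$, with $L=\begin{bmatrix}1&0\\1&1\end{bmatrix}$, $N=\begin{bmatrix}1&1\\0&1\end{bmatrix}$, $F=\begin{bmatrix}0&1\\1&0\end{bmatrix}$; let $\mathcal{M}$ be the free monoid generated by $L,N$ (the elements of $\mathrm{PSL}_2\mathbb{Z}$ with nonnegative entries). A slow continued fraction algorithm $T$ on $\Delta=[0,\infty]$ is given by a unimodular partition $\Delta_a=A_a*\Delta$ ($a=0,\dots,n-1$, $n\ge2$, listed left to right), where $A_a\in\Pi$ has nonnegative entries, and $T$ acts on $\Delta_a$ via $A_a^{ -1}$. Write uniquely $A_a=B_aF^{e(a)}$ with $B_a\in\mathcal{M}$, $e(a)\in\{0,1\}$. $\Sigma_T$ is the subgroup of $\Pi$ generated by $A_0,\dots,A_{n-1}$. The graph $\mathcal{G}_T$: start from two copies of the binary tree of $\mathcal{M}$ (vertices $B\in\mathcal{M}$ with $L$- and $N$-edges $B\to BL$, $B\to BN$, and twin vertices $BF$ with edges $BF\to BFL=BNF$, $BF\to BFN=BLF$), joined by $F$-edges $B\leftrightarrow BF$; keep only the vertices $B,BF$ with $B$ a left factor in $\mathcal{M}$ of some $B_a$. The leaves are the $B_a$ and $B_aF$. For each $a$, if $e(a)=0$ glue $B_a$ to the root $1$ and $B_aF$ to the vertex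 $2$ (the $F$-neighbour of $1$); if $e(a)=1$ glue $B_a$ to $2$ and $B_aF$ to $1$. The result is a finite rooted graph with exactly one $L$-, $N$-, $F$-edge leaving each vertex. $LN\text{ - }\mathcal{S}(\Sigma)$ is the Schreier graph of $\Sigma\le\Pi$ w.r.t. generators $\{L,N,F\}$: vertices are right cosets $\Sigma B$, root $\Sigma$, and an $X$-edge from $\Sigma B$ to $\Sigma BX$. An opfibration is a surjective homomorphism of rooted edge-labelled directed graphs which, for each vertex $y$, restricts to a bijection from the edges leaving $y$ to the edges leaving the image of $y$. -}

module Defs where

open import Data.Nat using (ℕ; zero; suc; _≤_)
open import Data.Integer using (ℤ; +_; -_; _+_; _*_; _-_; _≤ᵇ_)
open import Data.Fin using (Fin; toℕ)
open import Data.Bool using (Bool; true; false; not; _xor_; if_then_else_)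
open import Data.List using (List; []; _∷_; _++_; [_])
open import Data.Product using (Σ; ∃; ∃₂; _×_; _,_; proj₁)
open import Data.Sum using (_⊎_)
open import Relation.Binary.PropositionalEquality using (_≡_)

record Mat : Set where
  constructor mat
  field a b c d : ℤ

infixl 7 _·_
_·_ : Mat → Mat → Mat
mat a b c d · mat a' b' c' d' =
  mat (a * a' + b * c') (a * b' + b * d') (c * a' + d * c') (c * b' + d * d')

det : Mat → ℤ
det (mat a b c d) = a * d - b * c

-- adjugate; in PGL₂ℤ it represents the inverse (A⁻¹ = ± adj A)
adj : Mat → Mat
adj (mat a b c d) = mat d (- b) (- c) a

negM : Mat → Mat
negM (mat a b c d) = mat (- a) (- b) (- c) (- d)

I₂ Lmat Nmat Fmat : Mat
I₂   = mat (+ 1) (+ 0) (+ 0) (+ 1)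
Lmat = mat (+ 1) (+ 0) (+ 1) (+ 1)
Nmat = mat (+ 1) (+ 1) (+ 0) (+ 1)
Fmat = mat (+ 0) (+ 1) (+ 1) (+ 0)

-- representatives of elements of Π = PGL₂ℤ : determinant ±1
-- (two representatives M, negM M give the same element of Π)
InΠ : Mat → Set
InΠ M = det M ≡ + 1 ⊎ det M ≡ - (+ 1)

data Letter : Set where
  ℓL ℓN : Letter

data Label : Set where
  L N F : Label

letterLabel : Letter → Label
letterLabel ℓL = L
letterLabel ℓN = N

letterMat : Letter → Mat
letterMat ℓL = Lmat
letterMat ℓN = Nmat

labelMat : Label → Mat
labelMat L = Lmat
labelMat N = Nmat
labelMat F = Fmat

evalW : List Letter → Mat
evalW []      = I₂
evalW (x ∷ w) = letterMat x · evalW w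

IsPrefix : List Letter → List Letter → Set
IsPrefix u w = ∃ λ v → u ++ v ≡ w

Fpow : Bool → Mat
Fpow false = I₂
Fpow true  = Fmat

-- Intervals A * Δ, Δ = [0,∞], for A with nonnegative entries.
-- A point of [0,∞] is a pair (p , q) standing for p/q ((1,0) = ∞).
-- A·0 = (b , d), A·∞ = (a , c).

Point : Set
Point = ℤ × ℤ

-- p/q ≤ r/s  (for nonnegative entries)
_≤pt_ : Point → Point → Bool
(p , q) ≤pt (r , s) = (p * s) ≤ᵇ (r * q)

at0 at∞ : Mat → Point
at0 (mat a b c d) = (b , d)
at∞ (mat a b c d) = (a , c)

leftEnd rightEnd : Mat → Point
leftEnd  M = if at0 M ≤pt at∞ M then at0 M else at∞ M
rightEnd M = if at0 M ≤pt at∞ M then at∞ M else at0 M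

zeroPt ∞Pt : Point
zeroPt = (+ 0 , + 1)
∞Pt    = (+ 1 , + 0)

-- Slow continued fraction algorithm T, given by A_a = B_a F^{e(a)},
-- B_a ∈ 𝓜 (as a word), e(a) ∈ {0,1}; the intervals A_a * Δ form a
-- partition of [0,∞] listed from left to right.

Amat : ∀ {n} → (Fin n → List Letter) → (Fin n → Bool) → Fin n → Mat
Amat B e i = evalW (B i) · Fpow (e i)

record IsUnimodularPartition (n : ℕ) (B : Fin n → List Letter)
                             (e : Fin n → Bool) : Set where
  field
    first : ∀ i → toℕ i ≡ 0 → leftEnd (Amat B e i) ≡ zeroPt
    last  : ∀ i → suc (toℕ i) ≡ n → rightEnd (Amat B e i) ≡ ∞Pt
    adjacent : ∀ i j → toℕ j ≡ suc (toℕ i) →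
               rightEnd (Amat B e i) ≡ leftEnd (Amat B e j)

firstIx : ∀ n → 2 ≤ n → Fin n
firstIx (suc m) _ = Data.Fin.zero

record SlowCF : Set where
  field
    n    : ℕ
    2≤n  : 2 ≤ n
    B    : Fin n → List Letter
    e    : Fin n → Bool
    part : IsUnimodularPartition n B e

  A : Fin n → Mat
  A = Amat B e

-- Rooted edge-labelled directed graphs (vertices up to an equivalence;
-- for each vertex, source and label, edges are given by their target).

record LGraph : Set₁ where
  field
    V    : Set
    _≈_  : V → V → Set
    Edge : V → Label → V → Set
    root : V

record Opfibration (G H : LGraph) : Set where
  private
    module G = LGraph G
    module H = LGraph H
  field
    φ        : G.V → H.V
    φ-cong   : ∀ {x y} → x G.≈ y → φ x H.≈ φ y
    φ-root   : φ G.root H.≈ H.root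
    φ-edge   : ∀ {y X t} → G.Edge y X t → H.Edge (φ y) X (φ t)
    surj-V   : ∀ w → ∃ λ v → φ v H.≈ w
    surj-E   : ∀ {w X w'} → H.Edge w X w' →
               ∃₂ λ y t → G.Edge y X t × φ y H.≈ w × φ t H.≈ w'
    local-inj  : ∀ {y X t t'} → G.Edge y X t → G.Edge y X t' →
                 φ t H.≈ φ t' → t G.≈ t'
    local-surj : ∀ {y X w} → H.Edge (φ y) X w →
                 ∃ λ t → G.Edge y X t × φ t H.≈ w

module _ (T : SlowCF) where
  open SlowCF T

  data InΣ : Mat → Set where
    one    : InΣ I₂
    neg    : ∀ {S} → InΣ S → InΣ (negM S)
    mulA   : ∀ {S} i → InΣ S → InΣ (A i · S)
    mulInv : ∀ {S} i → InΣ S → InΣ (adj (A i) · S)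

  _≈coset_ : Mat → Mat → Set
  M ≈coset M' = ∃ λ S → InΣ S × M' ≡ S · M

  Schreier : LGraph
  Schreier = record
    { V    = Σ Mat InΠ
    ; _≈_  = λ x y → proj₁ x ≈coset proj₁ y
    ; Edge = λ x X y → proj₁ y ≈coset (proj₁ x · labelMat X)
    ; root = I₂ , Data.Sum.inj₁ _≡_.refl
    }

  FiniteIndex : Set
  FiniteIndex = ∃ λ (k : ℕ) → ∃ λ (reps : Fin k → Σ Mat InΠ) →
                ∀ (M : Σ Mat InΠ) → ∃ λ r → proj₁ M ≈coset proj₁ (reps r)

  -- The graph 𝓖_T.  Pre-gluing vertices: (u , f) with u a left factor of
  -- some B_a; f = false is the vertex u, f = true its twin uF.

  twist : Bool → Letter → Letter   -- uF·L = uNF, uF·N = uLF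
  twist false x  = x
  twist true  ℓL = ℓN
  twist true  ℓN = ℓL

  PreV : Set
  PreV = List Letter × Bool

  -- gluing: B_a F^f identified with root (f = e(a)) or vertex 2
  data _~G_ : PreV → PreV → Set where
    glue    : ∀ i f → (B i , f) ~G ([] , f xor e i)
    ~refl   : ∀ {p} → p ~G p
    ~sym    : ∀ {p q} → p ~G q → q ~G p
    ~trans  : ∀ {p q r} → p ~G q → q ~G r → p ~G r

  VG : Set
  VG = Σ PreV λ p → ∃ λ i → IsPrefix (proj₁ p) (B i)

  _≈G_ : VG → VG → Set
  x ≈G y = proj₁ x ~G proj₁ y

  -- edges of the two copies of the tree and the F-edges, before gluing
  data BaseEdge : VG → Label → VG → Set where
    treeE : ∀ {u f x} {pu pv} →
            BaseEdge ((u , f) , pu) (letterLabel x)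
                     ((u ++ [ twist f x ] , f) , pv)
    flipE : ∀ {u f} {pu pv} →
            BaseEdge ((u , f) , pu) F ((u , not f) , pv)

  rootG : VG
  rootG = ([] , false) , (firstIx n 2≤n , (B (firstIx n 2≤n) , _≡_.refl))

  GT : LGraph
  GT = record
    { V    = VG
    ; _≈_  = _≈G_
    ; Edge = λ y X t → ∃₂ λ y' t' → y ≈G y' × t ≈G t' × BaseEdge y' X t'
    ; root = rootG
    }

-- A vertex u F^f of 𝓖_T is sent to the coset Σ u F^f. This respects the gluing because
-- B_a F^f = A_a F^(f xor e(a)) with A_a ∈ Σ, and it maps edges to edges. It is a local bijection
-- because, once glued leaves are normalised, every vertex has exactly one outgoing edge of each
-- label; for the L- and N-edges this needs the B_a to form a complete prefix code, which follows
-- from the intervals B_a * [0,∞] tiling [0,∞] (locate the mediant of a prefix u among them).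
-- The image is a finite set of cosets containing Σ and closed under right multiplication by
-- L, N, F; by the pigeonhole principle it is closed under L⁻¹ and N⁻¹ as well, and since these
-- generate Π together with -1 (Euclid's algorithm on the first row), the image is all of Σ\Π.

module Submission where

open import Defs
open import Data.Bool using (true; false; not; _xor_)
open import Data.Bool.Properties using (not-distribˡ-xor)
open import Data.Empty using (⊥-elim)
open import Data.Fin using (Fin; toℕ; fromℕ<)
open import Data.List using (List; []; _∷_; _++_; [_]; length; take; drop)
open import Data.Nat using (ℕ; zero; suc; _≤_; _<_; s≤s)
open import Data.Product using (Σ; ∃; ∃₂; _×_; _,_; proj₁; proj₂; uncurry)
open import Data.Sum using (_⊎_; inj₁; inj₂)
open import Function.Bundles using (Inverse)
open import Level using (0ℓ)
open import Relation.Binary using (Setoid; DecidableEquality)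
import Relation.Binary.Reasoning.Setoid as SetoidReasoning
open import Relation.Binary.PropositionalEquality hiding ([_])
open import Relation.Nullary using (Dec; does; yes; no; ¬_; contradiction)
open import Relation.Nullary.Decidable using (dec-true; dec-false)

module Matrix where
  open import Data.Integer using (ℤ; +_; -_; _+_; _*_; _-_)
  open import Data.Integer.Tactic.RingSolver using (solve-∀)

  mat-cong : ∀ {a b c d a' b' c' d'} →
             a ≡ a' → b ≡ b' → c ≡ c' → d ≡ d' → mat a b c d ≡ mat a' b' c' d'
  mat-cong refl refl refl refl = refl

  scalar : ℤ → Mat
  scalar x = mat x (+ 0) (+ 0) x

  ·-assoc : ∀ M P Q → (M · P) · Q ≡ M · (P · Q)
  ·-assoc (mat a b c d) (mat e f g h) (mat i j k l) =
    mat-cong (entry a b e f g h i k) (entry a b e f g h j l)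
             (entry c d e f g h i k) (entry c d e f g h j l)
    where
    entry : ∀ a b e f g h i k →
            (a * e + b * g) * i + (a * f + b * h) * k ≡ a * (e * i + f * k) + b * (g * i + h * k)
    entry = solve-∀

  ·-identityˡ : ∀ M → I₂ · M ≡ M
  ·-identityˡ (mat a b c d) = mat-cong (top a c) (top b d) (bottom a c) (bottom b d)
    where
    top : ∀ a c → + 1 * a + + 0 * c ≡ a
    top = solve-∀
    bottom : ∀ a c → + 0 * a + + 1 * c ≡ c
    bottom = solve-∀

  ·-identityʳ : ∀ M → M · I₂ ≡ M
  ·-identityʳ (mat a b c d) = mat-cong (left a b) (right a b) (left c d) (right c d)
    where
    left : ∀ a b → a * + 1 + b * + 0 ≡ a
    left = solve-∀
    right : ∀ a b → a * + 0 + b * + 1 ≡ b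
    right = solve-∀

  det-· : ∀ M P → det (M · P) ≡ det M * det P
  det-· (mat a b c d) (mat e f g h) = cauchyBinet a b c d e f g h
    where
    cauchyBinet : ∀ a b c d e f g h →
      (a * e + b * g) * (c * f + d * h) - (a * f + b * h) * (c * e + d * g) ≡ (a * d - b * c) * (e * h - f * g)
    cauchyBinet = solve-∀

  adj-·ˡ : ∀ M → adj M · M ≡ scalar (det M)
  adj-·ˡ (mat a b c d) = mat-cong (diag₁ a b c d) (off₁ b d) (off₂ a c) (diag₂ a b c d)
    where
    diag₁ : ∀ a b c d → d * a + - b * c ≡ a * d - b * c
    diag₁ = solve-∀
    diag₂ : ∀ a b c d → - c * b + a * d ≡ a * d - b * c
    diag₂ = solve-∀
    off₁ : ∀ b d → d * b + - b * d ≡ + 0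
    off₁ = solve-∀
    off₂ : ∀ a c → - c * a + a * c ≡ + 0
    off₂ = solve-∀

  adj-·ʳ : ∀ M → M · adj M ≡ scalar (det M)
  adj-·ʳ (mat a b c d) = mat-cong (diag₁ a b c d) (off₁ a b) (off₂ c d) (diag₂ a b c d)
    where
    diag₁ : ∀ a b c d → a * d + b * - c ≡ a * d - b * c
    diag₁ = solve-∀
    diag₂ : ∀ a b c d → c * - b + d * a ≡ a * d - b * c
    diag₂ = solve-∀
    off₁ : ∀ a b → a * - b + b * a ≡ + 0
    off₁ = solve-∀
    off₂ : ∀ c d → c * d + d * - c ≡ + 0
    off₂ = solve-∀

  negM-·ˡ : ∀ M P → negM M · P ≡ negM (M · P)
  negM-·ˡ (mat a b c d) (mat e f g h) = mat-cong (entry a b e g) (entry a b f h) (entry c d e g) (entry c d f h)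
    where
    entry : ∀ a b e g → - a * e + - b * g ≡ - (a * e + b * g)
    entry = solve-∀

  negM-·ʳ : ∀ M P → M · negM P ≡ negM (M · P)
  negM-·ʳ (mat a b c d) (mat e f g h) = mat-cong (entry a b e g) (entry a b f h) (entry c d e g) (entry c d f h)
    where
    entry : ∀ a b e g → a * - e + b * - g ≡ - (a * e + b * g)
    entry = solve-∀

  negM-involutive : ∀ M → negM (negM M) ≡ M
  negM-involutive (mat a b c d) = mat-cong (entry a) (entry b) (entry c) (entry d)
    where
    entry : ∀ a → - - a ≡ a
    entry = solve-∀

  det-negM : ∀ M → det (negM M) ≡ det M
  det-negM (mat a b c d) = entry a b c d
    where
    entry : ∀ a b c d → - a * - d - - b * - c ≡ a * d - b * c
    entry = solve-∀

  ·-cancelʳ-inverse : ∀ M X Y → X · Y ≡ I₂ → (M · X) · Y ≡ M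
  ·-cancelʳ-inverse M X Y XY≡I = trans (·-assoc M X Y) (trans (cong (M ·_) XY≡I) (·-identityʳ M))

  InΠ-· : ∀ M P → InΠ M → InΠ P → InΠ (M · P)
  InΠ-· M P (inj₁ dM) (inj₁ dP) = inj₁ (trans (det-· M P) (cong₂ _*_ dM dP))
  InΠ-· M P (inj₁ dM) (inj₂ dP) = inj₂ (trans (det-· M P) (cong₂ _*_ dM dP))
  InΠ-· M P (inj₂ dM) (inj₁ dP) = inj₂ (trans (det-· M P) (cong₂ _*_ dM dP))
  InΠ-· M P (inj₂ dM) (inj₂ dP) = inj₁ (trans (det-· M P) (cong₂ _*_ dM dP))

  InΠ-negM : ∀ M → InΠ M → InΠ (negM M)
  InΠ-negM M = subst (λ x → x ≡ + 1 ⊎ x ≡ - + 1) (sym (det-negM M))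

  evalW-++ : ∀ u v → evalW (u ++ v) ≡ evalW u · evalW v
  evalW-++ []      v = sym (·-identityˡ (evalW v))
  evalW-++ (x ∷ u) v = trans (cong (letterMat x ·_) (evalW-++ u v))
                             (sym (·-assoc (letterMat x) (evalW u) (evalW v)))

  evalW-∷ʳ : ∀ u x → evalW (u ++ [ x ]) ≡ evalW u · letterMat x
  evalW-∷ʳ u x = trans (evalW-++ u [ x ]) (cong (evalW u ·_) (·-identityʳ (letterMat x)))

  InΠ-letterMat : ∀ x → InΠ (letterMat x)
  InΠ-letterMat ℓL = inj₁ refl
  InΠ-letterMat ℓN = inj₁ refl

  InΠ-evalW : ∀ u → InΠ (evalW u)
  InΠ-evalW []      = inj₁ refl
  InΠ-evalW (x ∷ u) = InΠ-· (letterMat x) (evalW u) (InΠ-letterMat x) (InΠ-evalW u)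

  InΠ-Fpow : ∀ f → InΠ (Fpow f)
  InΠ-Fpow false = inj₁ refl
  InΠ-Fpow true  = inj₂ refl

  Fpow-· : ∀ e f → Fpow e · Fpow f ≡ Fpow (f xor e)
  Fpow-· false false = refl
  Fpow-· false true  = refl
  Fpow-· true  false = refl
  Fpow-· true  true  = refl

  Fpow-·-xor : ∀ e f → Fpow e · Fpow (f xor e) ≡ Fpow f
  Fpow-·-xor false false = refl
  Fpow-·-xor false true  = refl
  Fpow-·-xor true  false = refl
  Fpow-·-xor true  true  = refl

module Generation where
  open Matrix
  open import Data.Nat as ℕ using (_∸_)
  import Data.Nat.Properties as ℕP
  open import Data.Integer using (+_; -_; -[1+_]; _+_; _*_; _-_; ∣_∣)
  import Data.Integer.Properties as ℤP
  open import Data.Integer.Tactic.RingSolver using (solve-∀)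

  Linv Ninv Dmat : Mat
  Linv = mat (+ 1) (+ 0) (- + 1) (+ 1)
  Ninv = mat (+ 1) (- + 1) (+ 0) (+ 1)
  Dmat = mat (+ 1) (+ 0) (+ 0) (- + 1)

  data IsGenerator : Mat → Set where
    genL   : IsGenerator Lmat
    genN   : IsGenerator Nmat
    genF   : IsGenerator Fmat
    genL⁻¹ : IsGenerator Linv
    genN⁻¹ : IsGenerator Ninv

  data Generated : Mat → Set where
    gen-I   : Generated I₂
    gen-·   : ∀ {M X} → Generated M → IsGenerator X → Generated (M · X)
    gen-neg : ∀ {M} → Generated M → Generated (negM M)

  ·Linv : ∀ a b c d → mat a b c d · Linv ≡ mat (a - b) b (c - d) d
  ·Linv a b c d = mat-cong (left a b) (right a b) (left c d) (right c d)
    where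
    left : ∀ a b → a * + 1 + b * - + 1 ≡ a - b
    left = solve-∀
    right : ∀ a b → a * + 0 + b * + 1 ≡ b
    right = solve-∀

  ·Ninv : ∀ a b c d → mat a b c d · Ninv ≡ mat a (b - a) c (d - c)
  ·Ninv a b c d = mat-cong (left a b) (right a b) (left c d) (right c d)
    where
    left : ∀ a b → a * + 1 + b * + 0 ≡ a
    left = solve-∀
    right : ∀ a b → a * - + 1 + b * + 1 ≡ b - a
    right = solve-∀

  ·Fmat : ∀ a b c d → mat a b c d · Fmat ≡ mat b a d c
  ·Fmat a b c d = mat-cong (left a b) (right a b) (left c d) (right c d)
    where
    left : ∀ a b → a * + 0 + b * + 1 ≡ b
    left = solve-∀
    right : ∀ a b → a * + 1 + b * + 0 ≡ a
    right = solve-∀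

  ·Dmat : ∀ a b c d → mat a b c d · Dmat ≡ mat a (- b) c (- d)
  ·Dmat a b c d = mat-cong (left a b) (right a b) (left c d) (right c d)
    where
    left : ∀ a b → a * + 1 + b * + 0 ≡ a
    left = solve-∀
    right : ∀ a b → a * + 0 + b * - + 1 ≡ - b
    right = solve-∀

  Generated-·Dmat : ∀ {M} → Generated M → Generated (M · Dmat)
  Generated-·Dmat {M} g =
    subst Generated (trans (cong negM (·-assoc3 M)) (sym (negM-·ʳ M (Lmat · (Ninv · (Lmat · Fmat))))))
          (gen-neg (gen-· (gen-· (gen-· (gen-· g genL) genN⁻¹) genL) genF))
    where
    ·-assoc3 : ∀ M → (((M · Lmat) · Ninv) · Lmat) · Fmat ≡ M · (Lmat · (Ninv · (Lmat · Fmat)))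
    ·-assoc3 M = trans (·-assoc ((M · Lmat) · Ninv) Lmat Fmat)
                  (trans (·-assoc (M · Lmat) Ninv (Lmat · Fmat)) (·-assoc M Lmat (Ninv · (Lmat · Fmat))))

  Generated-reduce : ∀ {M M'} X Y → X · Y ≡ I₂ → (∀ {P} → Generated P → Generated (P · Y)) → InΠ X →
                     M · X ≡ M' → InΠ M → (InΠ M' → Generated M') → Generated M
  Generated-reduce {M} X Y XY≡I closed X∈Π MX≡M' M∈Π generate =
    subst Generated (·-cancelʳ-inverse M X Y XY≡I)
      (closed (subst Generated (sym MX≡M') (generate (subst InΠ MX≡M' (InΠ-· M X M∈Π X∈Π)))))

  Generated-negM⁻¹ : ∀ {M} → Generated (negM M) → Generated M
  Generated-negM⁻¹ {M} g = subst Generated (negM-involutive M) (gen-neg g)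

  lowerUnitriangular-·Lmat : ∀ c → mat (+ 1) (+ 0) c (+ 1) · Lmat ≡ mat (+ 1) (+ 0) (+ 1 + c) (+ 1)
  lowerUnitriangular-·Lmat c = mat-cong refl refl (entry c) (corner c)
    where
    entry : ∀ c → c * + 1 + + 1 * + 1 ≡ + 1 + c
    entry = solve-∀
    corner : ∀ c → c * + 0 + + 1 * + 1 ≡ + 1
    corner = solve-∀

  lowerUnitriangular-·Linv : ∀ c → mat (+ 1) (+ 0) c (+ 1) · Linv ≡ mat (+ 1) (+ 0) (- + 1 + c) (+ 1)
  lowerUnitriangular-·Linv c = mat-cong refl refl (entry c) (corner c)
    where
    entry : ∀ c → c * + 1 + + 1 * - + 1 ≡ - + 1 + c
    entry = solve-∀
    corner : ∀ c → c * + 0 + + 1 * + 1 ≡ + 1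
    corner = solve-∀

  Generated-lowerUnitriangular : ∀ c → Generated (mat (+ 1) (+ 0) c (+ 1))
  Generated-lowerUnitriangular (+ zero)     = gen-I
  Generated-lowerUnitriangular (+ suc k)    =
    subst Generated (lowerUnitriangular-·Lmat (+ k)) (gen-· (Generated-lowerUnitriangular (+ k)) genL)
  Generated-lowerUnitriangular -[1+ zero ]  = gen-· gen-I genL⁻¹
  Generated-lowerUnitriangular -[1+ suc k ] =
    subst Generated (lowerUnitriangular-·Linv -[1+ k ]) (gen-· (Generated-lowerUnitriangular -[1+ k ]) genL⁻¹)

  InΠ-first-row-x0 : ∀ x c d → InΠ (mat (+ x) (+ 0) c d) → x ≡ 1 × (d ≡ + 1 ⊎ d ≡ - + 1)
  InΠ-first-row-x0 x c d M∈Π =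
    ℕP.m*n≡1⇒m≡1 x ∣ d ∣ x∣d∣≡1 , ∣d∣≡1 d (ℕP.m*n≡1⇒n≡1 x ∣ d ∣ x∣d∣≡1)
    where
    det≡ : ∀ x c d → x * d - + 0 * c ≡ x * d
    det≡ = solve-∀
    ∣unit∣ : ∀ {z} → z ≡ + 1 ⊎ z ≡ - + 1 → ∣ z ∣ ≡ 1
    ∣unit∣ (inj₁ refl) = refl
    ∣unit∣ (inj₂ refl) = refl
    x∣d∣≡1 : x ℕ.* ∣ d ∣ ≡ 1
    x∣d∣≡1 = trans (sym (ℤP.abs-* (+ x) d))
                   (∣unit∣ (subst (λ z → z ≡ + 1 ⊎ z ≡ - + 1) (det≡ (+ x) c d) M∈Π))
    ∣d∣≡1 : ∀ d → ∣ d ∣ ≡ 1 → d ≡ + 1 ⊎ d ≡ - + 1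
    ∣d∣≡1 (+ .1)       refl = inj₁ refl
    ∣d∣≡1 -[1+ zero ]  refl = inj₂ refl

  Generated-first-row-x0 : ∀ x c d → InΠ (mat (+ x) (+ 0) c d) → Generated (mat (+ x) (+ 0) c d)
  Generated-first-row-x0 x c d M∈Π with InΠ-first-row-x0 x c d M∈Π
  ... | refl , inj₁ refl = Generated-lowerUnitriangular c
  ... | refl , inj₂ refl = Generated-reduce Dmat Dmat refl Generated-·Dmat (inj₂ refl)
                             (·Dmat (+ 1) (+ 0) c (- + 1)) M∈Π (λ _ → Generated-lowerUnitriangular c)

  +-minus-+ : ∀ {m n} → n ℕ.≤ m → + m - + n ≡ + (m ∸ n)
  +-minus-+ {m} {n} n≤m = trans (ℤP.m-n≡m⊖n m n) (ℤP.⊖-≥ n≤m)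

  -- the Euclidean algorithm on a nonnegative first row, with fuel k
  Generated-nonneg-first-row : ∀ k x y c d → x ℕ.+ y ℕ.≤ k → InΠ (mat (+ x) (+ y) c d) →
                               Generated (mat (+ x) (+ y) c d)
  Generated-nonneg-first-row k x zero c d _ M∈Π = Generated-first-row-x0 x c d M∈Π
  Generated-nonneg-first-row k zero (suc y) c d _ M∈Π =
    Generated-reduce Fmat Fmat refl (λ g → gen-· g genF) (inj₂ refl)
      (·Fmat (+ 0) (+ suc y) c d) M∈Π (Generated-first-row-x0 (suc y) d c)
  Generated-nonneg-first-row (suc k) (suc x) (suc y) c d (s≤s x+1+y≤k) M∈Π with suc y ℕ.≤? suc x
  ... | yes y≤x =
    Generated-reduce Linv Lmat refl (λ g → gen-· g genL) (inj₁ refl)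
      reduced M∈Π (Generated-nonneg-first-row k (x ∸ y) (suc y) (c - d) d bound)
    where
    reduced : mat (+ suc x) (+ suc y) c d · Linv ≡ mat (+ (x ∸ y)) (+ suc y) (c - d) d
    reduced = trans (·Linv (+ suc x) (+ suc y) c d) (cong (λ z → mat z (+ suc y) (c - d) d) (+-minus-+ y≤x))
    bound : x ∸ y ℕ.+ suc y ℕ.≤ k
    bound = ℕP.≤-trans (ℕP.+-monoˡ-≤ (suc y) (ℕP.m∸n≤m x y)) x+1+y≤k
  ... | no y≰x =
    Generated-reduce Ninv Nmat refl (λ g → gen-· g genN) (inj₁ refl)
      reduced M∈Π (Generated-nonneg-first-row k (suc x) (y ∸ x) c (d - c) bound)
    where
    reduced : mat (+ suc x) (+ suc y) c d · Ninv ≡ mat (+ suc x) (+ (y ∸ x)) c (d - c)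
    reduced = trans (·Ninv (+ suc x) (+ suc y) c d)
                    (cong (λ z → mat (+ suc x) z c (d - c)) (+-minus-+ (ℕP.<⇒≤ (ℕP.≰⇒> y≰x))))
    bound : suc x ℕ.+ (y ∸ x) ℕ.≤ k
    bound = ℕP.≤-trans (ℕP.+-mono-≤ (ℕP.≤-refl {suc x}) (ℕP.m∸n≤m y x)) (subst (ℕ._≤ k) (ℕP.+-suc x y) x+1+y≤k)

  Generated-nonneg-first-entry : ∀ x b c d → InΠ (mat (+ x) b c d) → Generated (mat (+ x) b c d)
  Generated-nonneg-first-entry x (+ y) c d M∈Π = Generated-nonneg-first-row (x ℕ.+ y) x y c d ℕP.≤-refl M∈Π
  Generated-nonneg-first-entry x -[1+ y ] c d M∈Π =
    Generated-reduce Dmat Dmat refl Generated-·Dmat (inj₂ refl)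
      (·Dmat (+ x) -[1+ y ] c d) M∈Π (Generated-nonneg-first-row (x ℕ.+ suc y) x (suc y) c (- d) ℕP.≤-refl)

  InΠ⇒Generated : ∀ M → InΠ M → Generated M
  InΠ⇒Generated (mat (+ x) b c d) M∈Π = Generated-nonneg-first-entry x b c d M∈Π
  InΠ⇒Generated (mat -[1+ x ] b c d) M∈Π =
    Generated-negM⁻¹ (Generated-nonneg-first-entry (suc x) (- b) (- c) (- d) (InΠ-negM (mat -[1+ x ] b c d) M∈Π))

module ProjectiveInterval where
  open import Data.Nat using (_+_; _*_; z≤n)
  open import Relation.Nullary.Decidable using (map′)
  open import Data.Nat.Properties
  open import Data.Nat.Tactic.RingSolver using (solve-∀)

  -- p = (a , b) stands for a / b ∈ [0 , ∞]
  Pt : Set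
  Pt = ℕ × ℕ

  record _≤P_ (p q : Pt) : Set where
    constructor cross≤
    field cross : proj₁ p * proj₂ q ≤ proj₁ q * proj₂ p

  record _<P_ (p q : Pt) : Set where
    constructor cross<
    field cross : proj₁ p * proj₂ q < proj₁ q * proj₂ p

  NonNull : Pt → Set
  NonNull (a , b) = 1 ≤ a + b

  zeroP oneP ∞P : Pt
  zeroP = (0 , 1)
  oneP  = (1 , 1)
  ∞P    = (1 , 0)

  act : Letter → Pt → Pt
  act ℓL (a , b) = (a , a + b)
  act ℓN (a , b) = (a + b , b)

  actW : List Letter → Pt → Pt
  actW []      p = p
  actW (x ∷ w) p = act x (actW w p)

  -- the endpoints of the interval evalW w * [0 , ∞]
  left right : List Letter → Pt
  left  w = actW w zeroP
  right w = actW w ∞P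

  actW-++ : ∀ u v p → actW (u ++ v) p ≡ actW u (actW v p)
  actW-++ []      v p = refl
  actW-++ (x ∷ u) v p = cong (act x) (actW-++ u v p)

  private
    distribL₁ : ∀ a c d → a * (c + d) ≡ a * c + a * d
    distribL₁ = solve-∀
    distribL₂ : ∀ a b c → c * (a + b) ≡ a * c + c * b
    distribL₂ = solve-∀
    distribN₁ : ∀ a b d → (a + b) * d ≡ b * d + a * d
    distribN₁ = solve-∀
    distribN₂ : ∀ b c d → (c + d) * b ≡ b * d + c * b
    distribN₂ = solve-∀

  act-mono-≤ : ∀ x {p q} → p ≤P q → act x p ≤P act x q
  act-mono-≤ ℓL {a , b} {c , d} (cross≤ h) =
    cross≤ (subst₂ _≤_ (sym (distribL₁ a c d)) (sym (distribL₂ a b c)) (+-monoʳ-≤ (a * c) h))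
  act-mono-≤ ℓN {a , b} {c , d} (cross≤ h) =
    cross≤ (subst₂ _≤_ (sym (distribN₁ a b d)) (sym (distribN₂ b c d)) (+-monoʳ-≤ (b * d) h))

  act-mono-< : ∀ x {p q} → p <P q → act x p <P act x q
  act-mono-< ℓL {a , b} {c , d} (cross< h) =
    cross< (subst₂ _<_ (sym (distribL₁ a c d)) (sym (distribL₂ a b c)) (+-monoʳ-< (a * c) h))
  act-mono-< ℓN {a , b} {c , d} (cross< h) =
    cross< (subst₂ _<_ (sym (distribN₁ a b d)) (sym (distribN₂ b c d)) (+-monoʳ-< (b * d) h))

  actW-mono-≤ : ∀ w {p q} → p ≤P q → actW w p ≤P actW w q
  actW-mono-≤ []      h = h
  actW-mono-≤ (x ∷ w) h = act-mono-≤ x (actW-mono-≤ w h)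

  actW-mono-< : ∀ w {p q} → p <P q → actW w p <P actW w q
  actW-mono-< []      h = h
  actW-mono-< (x ∷ w) h = act-mono-< x (actW-mono-< w h)

  zeroP-≤P : ∀ p → zeroP ≤P p
  zeroP-≤P _ = cross≤ z≤n

  ≤P-∞P : ∀ p → p ≤P ∞P
  ≤P-∞P (a , b) = cross≤ (subst (_≤ 1 * b) (sym (*-zeroʳ a)) z≤n)

  actW-nonNull : ∀ w p → NonNull p → NonNull (actW w p)
  actW-nonNull []       p h = h
  actW-nonNull (ℓL ∷ w) p h = ≤-trans (actW-nonNull w p h) (m≤n+m _ (proj₁ (actW w p)))
  actW-nonNull (ℓN ∷ w) p h = ≤-trans (actW-nonNull w p h) (m≤m+n _ (proj₂ (actW w p)))

  left-nonNull : ∀ w → NonNull (left w)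
  left-nonNull w = actW-nonNull w zeroP (s≤s z≤n)

  right-nonNull : ∀ w → NonNull (right w)
  right-nonNull w = actW-nonNull w ∞P (s≤s z≤n)

  actW-positive : ∀ w p → 1 ≤ proj₁ p → 1 ≤ proj₂ p → 1 ≤ proj₁ (actW w p) × 1 ≤ proj₂ (actW w p)
  actW-positive []       p h₁ h₂ = h₁ , h₂
  actW-positive (ℓL ∷ w) p h₁ h₂ =
    let (a≥1 , b≥1) = actW-positive w p h₁ h₂ in a≥1 , ≤-trans b≥1 (m≤n+m _ _)
  actW-positive (ℓN ∷ w) p h₁ h₂ =
    let (a≥1 , b≥1) = actW-positive w p h₁ h₂ in ≤-trans a≥1 (m≤m+n _ _) , b≥1

  left<right : ∀ w → left w <P right w
  left<right w = actW-mono-< w (cross< (s≤s z≤n))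

  ≤P-reflexive : ∀ {p q} → p ≡ q → p ≤P q
  ≤P-reflexive refl = cross≤ ≤-refl

  ≤P-trans : ∀ {p} q {r} → NonNull q → p ≤P q → q ≤P r → p ≤P r
  ≤P-trans {p₁ , p₂} (q₁ , suc k) {r₁ , r₂} _ (cross≤ p≤q) (cross≤ q≤r) =
    cross≤ (*-cancelʳ-≤ (p₁ * r₂) (r₁ * p₂) (suc k) (begin
      p₁ * r₂ * suc k  ≡⟨ swap p₁ r₂ (suc k) ⟩
      p₁ * suc k * r₂  ≤⟨ *-monoˡ-≤ r₂ p≤q ⟩
      q₁ * p₂ * r₂     ≡⟨ swap q₁ p₂ r₂ ⟩
      q₁ * r₂ * p₂     ≤⟨ *-monoˡ-≤ p₂ q≤r ⟩
      r₁ * suc k * p₂  ≡⟨ swap r₁ (suc k) p₂ ⟩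
      r₁ * p₂ * suc k  ∎))
    where
    open ≤-Reasoning
    swap : ∀ a b c → a * b * c ≡ a * c * b
    swap = solve-∀
  ≤P-trans {p₁ , p₂} (suc q₁ , zero) {r₁ , r₂} _ _ (cross≤ q≤r)
    with r₂ | n≤0⇒n≡0 (≤-trans q≤r (≤-reflexive (*-zeroʳ r₁)))
  ... | zero | _ = cross≤ (subst (_≤ r₁ * p₂) (sym (*-zeroʳ p₁)) z≤n)

  ≤P⇒≯P : ∀ {p q} → p ≤P q → ¬ (q <P p)
  ≤P⇒≯P (cross≤ p≤q) (cross< q<p) = <⇒≱ q<p p≤q

  <P⇒≤P : ∀ {p q} → p <P q → p ≤P q
  <P⇒≤P (cross< h) = cross≤ (<⇒≤ h)

  _≤P?_ : ∀ p q → Dec (p ≤P q)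
  (a , b) ≤P? (c , d) = map′ cross≤ _≤P_.cross (a * d ≤? c * b)

  _<P?_ : ∀ p q → Dec (p <P q)
  (a , b) <P? (c , d) = map′ cross< _<P_.cross (a * d <? c * b)

  ≰P⇒>P : ∀ {p q} → ¬ (p ≤P q) → q <P p
  ≰P⇒>P p≰q = cross< (≰⇒> (λ h → p≰q (cross≤ h)))

  ≮P⇒≥P : ∀ {p q} → ¬ (p <P q) → q ≤P p
  ≮P⇒≥P p≮q = cross≤ (≮⇒≥ (λ h → p≮q (cross< h)))

  left-++ : ∀ u v → left u ≤P left (u ++ v)
  left-++ u v = subst (left u ≤P_) (sym (actW-++ u v zeroP)) (actW-mono-≤ u (zeroP-≤P (left v)))

  right-++ : ∀ u v → right (u ++ v) ≤P right u
  right-++ u v = subst (_≤P right u) (sym (actW-++ u v ∞P)) (actW-mono-≤ u (≤P-∞P (right v)))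

  -- u·(1,1) is the common endpoint of the intervals of uL and uN
  mediant : List Letter → Pt
  mediant u = actW u oneP

  right-++L∷ : ∀ u v → right (u ++ ℓL ∷ v) ≤P mediant u
  right-++L∷ u v = subst (_≤P mediant u) (sym (actW-++ u (ℓL ∷ v) ∞P))
                         (actW-mono-≤ u (act-mono-≤ ℓL (≤P-∞P (right v))))

  mediant-≤P-left-++N∷ : ∀ u v → mediant u ≤P left (u ++ ℓN ∷ v)
  mediant-≤P-left-++N∷ u v = subst (mediant u ≤P_) (sym (actW-++ u (ℓN ∷ v) zeroP))
                                   (actW-mono-≤ u (act-mono-≤ ℓN (zeroP-≤P (left v))))

  left<mediant : ∀ u → left u <P mediant u
  left<mediant u = actW-mono-< u (cross< (s≤s z≤n))

  mediant<right : ∀ u → mediant u <P right u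
  mediant<right u = actW-mono-< u (cross< (s≤s z≤n))

  mediant-nonzero : ∀ u → zeroP <P mediant u
  mediant-nonzero u with actW-positive u oneP (s≤s z≤n) (s≤s z≤n)
  ... | a≥1 , _ = cross< (subst (1 ≤_) (sym (*-identityʳ _)) a≥1)

  mediant-finite : ∀ u → mediant u <P ∞P
  mediant-finite u with actW-positive u oneP (s≤s z≤n) (s≤s z≤n)
  ... | _ , b≥1 = cross< (subst₂ _<_ (sym (*-zeroʳ (proj₁ (mediant u)))) (sym (+-identityʳ _)) b≥1)

  PrefixOrDisjoint : List Letter → List Letter → Set
  PrefixOrDisjoint u w = IsPrefix u w ⊎ IsPrefix w u ⊎ right u ≤P left w ⊎ right w ≤P left u

  ∷-PrefixOrDisjoint : ∀ x {u w} → PrefixOrDisjoint u w → PrefixOrDisjoint (x ∷ u) (x ∷ w)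
  ∷-PrefixOrDisjoint x (inj₁ (v , u++v≡w))         = inj₁ (v , cong (x ∷_) u++v≡w)
  ∷-PrefixOrDisjoint x (inj₂ (inj₁ (v , w++v≡u)))  = inj₂ (inj₁ (v , cong (x ∷_) w++v≡u))
  ∷-PrefixOrDisjoint x (inj₂ (inj₂ (inj₁ ru≤lw)))  = inj₂ (inj₂ (inj₁ (act-mono-≤ x ru≤lw)))
  ∷-PrefixOrDisjoint x (inj₂ (inj₂ (inj₂ rw≤lu)))  = inj₂ (inj₂ (inj₂ (act-mono-≤ x rw≤lu)))

  right-L∷≤P-left-N∷ : ∀ u w → right (ℓL ∷ u) ≤P left (ℓN ∷ w)
  right-L∷≤P-left-N∷ u w =
    ≤P-trans oneP (s≤s z≤n) (act-mono-≤ ℓL (≤P-∞P (right u))) (act-mono-≤ ℓN (zeroP-≤P (left w)))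

  prefixOrDisjoint : ∀ u w → PrefixOrDisjoint u w
  prefixOrDisjoint []       w        = inj₁ (w , refl)
  prefixOrDisjoint (x ∷ u)  []       = inj₂ (inj₁ (x ∷ u , refl))
  prefixOrDisjoint (ℓL ∷ u) (ℓL ∷ w) = ∷-PrefixOrDisjoint ℓL (prefixOrDisjoint u w)
  prefixOrDisjoint (ℓN ∷ u) (ℓN ∷ w) = ∷-PrefixOrDisjoint ℓN (prefixOrDisjoint u w)
  prefixOrDisjoint (ℓL ∷ u) (ℓN ∷ w) = inj₂ (inj₂ (inj₁ (right-L∷≤P-left-N∷ u w)))
  prefixOrDisjoint (ℓN ∷ u) (ℓL ∷ w) = inj₂ (inj₂ (inj₂ (right-L∷≤P-left-N∷ w u)))

open ProjectiveInterval

module WordPartition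
    (n : ℕ) (B : Fin n → List Letter) (2≤n : 2 ≤ n)
    (left-first : ∀ i → toℕ i ≡ 0 → left (B i) ≡ zeroP)
    (right-last : ∀ i → suc (toℕ i) ≡ n → right (B i) ≡ ∞P)
    (right≡left-next : ∀ i j → toℕ j ≡ suc (toℕ i) → right (B i) ≡ left (B j))
  where
  open import Data.Nat using (_+_; _∸_; z≤n)
  open import Data.Nat.Properties
  import Data.Fin.Properties as Fin
  import Data.List.Properties as List
  open import Relation.Binary using (tri<; tri≈; tri>)

  right≤left-after : ∀ d i j → toℕ j ≡ suc (d + toℕ i) → right (B i) ≤P left (B j)
  right≤left-after zero    i j j≡i+1 = ≤P-reflexive (right≡left-next i j j≡i+1)
  right≤left-after (suc d) i j j≡i+d+2 =
    ≤P-trans (left (B k)) (left-nonNull (B k)) (right≤left-after d i k (Fin.toℕ-fromℕ< k<n))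
      (≤P-trans (right (B k)) (right-nonNull (B k)) (<P⇒≤P (left<right (B k)))
        (≤P-reflexive (right≡left-next k j (trans j≡i+d+2 (cong suc (sym (Fin.toℕ-fromℕ< k<n)))))))
    where
    k<n : suc (d + toℕ i) < n
    k<n = <-trans (n<1+n _) (subst (_< n) j≡i+d+2 (Fin.toℕ<n j))
    k : Fin n
    k = fromℕ< k<n

  right≤left : ∀ i j → toℕ i < toℕ j → right (B i) ≤P left (B j)
  right≤left i j i<j with m≤n⇒∃[o]m+o≡n i<j
  ... | d , i+1+d≡j = right≤left-after d i j (trans (sym i+1+d≡j) (cong suc (+-comm (toℕ i) d)))

  B-prefix⇒≡ : ∀ {k j v} → B k ++ v ≡ B j → k ≡ j
  B-prefix⇒≡ {k} {j} {v} Bk++v≡Bj with <-cmp (toℕ k) (toℕ j)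
  ... | tri≈ _ k≡j _ = Fin.toℕ-injective k≡j
  ... | tri< k<j _ _ = ⊥-elim (≤P⇒≯P (≤P-trans (right (B k)) (right-nonNull (B k)) rj≤rk (right≤left k j k<j))
                                     (left<right (B j)))
    where
    rj≤rk : right (B j) ≤P right (B k)
    rj≤rk = subst (λ w → right w ≤P right (B k)) Bk++v≡Bj (right-++ (B k) v)
  ... | tri> _ _ j<k = ⊥-elim (≤P⇒≯P (≤P-trans (left (B k)) (left-nonNull (B k)) (right≤left j k j<k) lk≤lj)
                                     (left<right (B j)))
    where
    lk≤lj : left (B k) ≤P left (B j)
    lk≤lj = subst (λ w → left (B k) ≤P left w) Bk++v≡Bj (left-++ (B k) v)

  B-prefixFree : ∀ {k j v} → B k ++ v ≡ B j → v ≡ []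
  B-prefixFree {k} {j} {v} Bk++v≡Bj with B-prefix⇒≡ Bk++v≡Bj
  ... | refl = List.++-identityʳ-unique (B k) (sym Bk++v≡Bj)

  B-nonempty : ∀ i → B i ≢ []
  B-nonempty i Bi≡[] =
    0≢1 (trans (sym (Fin.toℕ-fromℕ< 0<n)) (trans (cong toℕ (trans (sym i≡0) i≡1)) (Fin.toℕ-fromℕ< 2≤n)))
    where
    0<n : 0 < n
    0<n = <-trans (s≤s z≤n) 2≤n
    i≡0 : i ≡ fromℕ< 0<n
    i≡0 = B-prefix⇒≡ (cong (_++ B (fromℕ< 0<n)) Bi≡[])
    i≡1 : i ≡ fromℕ< 2≤n
    i≡1 = B-prefix⇒≡ (cong (_++ B (fromℕ< 2≤n)) Bi≡[])
    0≢1 : 0 ≢ 1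
    0≢1 ()

  crossing : ∀ (P : Pt → Set) → (∀ p → Dec (P p)) → P zeroP → ¬ P ∞P →
             ∃ λ i → P (left (B i)) × ¬ P (right (B i))
  crossing P P? P0 ¬P∞ = walk (n ∸ 1) first first+n-1≡n (subst P (sym (left-first first (Fin.toℕ-fromℕ< 0<n))) P0)
    where
    0<n : 0 < n
    0<n = <-trans (s≤s z≤n) 2≤n
    first : Fin n
    first = fromℕ< 0<n
    first+n-1≡n : suc (toℕ first + (n ∸ 1)) ≡ n
    first+n-1≡n = trans (cong (λ z → suc (z + (n ∸ 1))) (Fin.toℕ-fromℕ< 0<n)) (m+[n∸m]≡n {1} {n} 0<n)
    walk : ∀ d i → suc (toℕ i + d) ≡ n → P (left (B i)) → ∃ λ i → P (left (B i)) × ¬ P (right (B i))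
    walk d i _ Pl with P? (right (B i))
    ... | no ¬Pr = i , Pl , ¬Pr
    walk zero i i+0+1≡n _ | yes Pr =
      ⊥-elim (¬P∞ (subst P (right-last i (trans (cong suc (sym (+-identityʳ (toℕ i)))) i+0+1≡n)) Pr))
    walk (suc d) i i+d+2≡n _ | yes Pr =
      walk d j (trans (cong (λ z → suc (z + d)) j≡i+1) (trans (cong suc (sym (+-suc (toℕ i) d))) i+d+2≡n))
               (subst P (right≡left-next i j j≡i+1) Pr)
      where
      j<n : suc (toℕ i) < n
      j<n = subst (suc (toℕ i) <_) i+d+2≡n
                  (s≤s (≤-trans (s≤s (m≤m+n (toℕ i) d)) (≤-reflexive (sym (+-suc (toℕ i) d)))))
      j : Fin n
      j = fromℕ< j<n
      j≡i+1 : toℕ j ≡ suc (toℕ i)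
      j≡i+1 = Fin.toℕ-fromℕ< j<n

  cover-≤< : ∀ m → m <P ∞P → ∃ λ j → left (B j) ≤P m × m <P right (B j)
  cover-≤< m m<∞ with crossing (_≤P m) (_≤P? m) (zeroP-≤P m) (λ ∞≤m → ≤P⇒≯P ∞≤m m<∞)
  ... | j , lj≤m , rj≰m = j , lj≤m , ≰P⇒>P rj≰m

  cover-<≤ : ∀ m → zeroP <P m → ∃ λ j → left (B j) <P m × m ≤P right (B j)
  cover-<≤ m 0<m with crossing (_<P m) (_<P? m) 0<m (≤P⇒≯P (≤P-∞P m))
  ... | j , lj<m , rj≮m = j , lj<m , ≮P⇒≥P rj≮m

  continues-or-outside : ∀ {u z v i} → u ++ z ∷ v ≡ B i → ∀ j →
    (∃₂ λ x v' → u ++ x ∷ v' ≡ B j) ⊎ right (B j) ≤P left u ⊎ right u ≤P left (B j)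
  continues-or-outside {u} {z} {v} {i} u++z∷v≡Bi j with prefixOrDisjoint u (B j)
  ... | inj₁ ([] , u++[]≡Bj) = contradiction (B-prefixFree (trans (cong (_++ z ∷ v) Bj≡u) u++z∷v≡Bi)) λ ()
    where
    Bj≡u : B j ≡ u
    Bj≡u = trans (sym u++[]≡Bj) (List.++-identityʳ u)
  ... | inj₁ (x ∷ v' , u++x∷v'≡Bj) = inj₁ (x , v' , u++x∷v'≡Bj)
  ... | inj₂ (inj₁ (v' , Bj++v'≡u)) = contradiction (List.++-conicalʳ v' (z ∷ v) (B-prefixFree Bj++v'++z∷v≡Bi)) λ ()
    where
    Bj++v'++z∷v≡Bi : B j ++ v' ++ z ∷ v ≡ B i
    Bj++v'++z∷v≡Bi = trans (sym (List.++-assoc (B j) v' (z ∷ v))) (trans (cong (_++ z ∷ v) Bj++v'≡u) u++z∷v≡Bi)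
  ... | inj₂ (inj₂ (inj₁ ru≤lBj)) = inj₂ (inj₂ ru≤lBj)
  ... | inj₂ (inj₂ (inj₂ rBj≤lu)) = inj₂ (inj₁ rBj≤lu)

  -- The tree of left factors of the B i is complete: the B j whose interval contains the mediant
  -- of u must extend u by the missing letter.
  extend : ∀ {u z v i} → u ++ z ∷ v ≡ B i → ∀ z' → ∃₂ λ j v' → u ++ z' ∷ v' ≡ B j
  extend {z = ℓL} u++z∷v≡Bi ℓL = _ , _ , u++z∷v≡Bi
  extend {z = ℓN} u++z∷v≡Bi ℓN = _ , _ , u++z∷v≡Bi
  extend {u} {ℓL} u++z∷v≡Bi ℓN with cover-≤< (mediant u) (mediant-finite u)
  ... | j , lj≤m , m<rj with continues-or-outside u++z∷v≡Bi j
  ...   | inj₁ (ℓN , v' , u++N∷v'≡Bj) = j , v' , u++N∷v'≡Bj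
  ...   | inj₁ (ℓL , v' , u++L∷v'≡Bj) =
    ⊥-elim (≤P⇒≯P (subst (λ w → right w ≤P mediant u) u++L∷v'≡Bj (right-++L∷ u v')) m<rj)
  ...   | inj₂ (inj₁ rj≤lu) =
    ⊥-elim (≤P⇒≯P (≤P-trans (left u) (left-nonNull u) rj≤lu (<P⇒≤P (left<mediant u))) m<rj)
  ...   | inj₂ (inj₂ ru≤lj) =
    ⊥-elim (≤P⇒≯P (≤P-trans (left (B j)) (left-nonNull (B j)) ru≤lj lj≤m) (mediant<right u))
  extend {u} {ℓN} u++z∷v≡Bi ℓL with cover-<≤ (mediant u) (mediant-nonzero u)
  ... | j , lj<m , m≤rj with continues-or-outside u++z∷v≡Bi j
  ...   | inj₁ (ℓL , v' , u++L∷v'≡Bj) = j , v' , u++L∷v'≡Bj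
  ...   | inj₁ (ℓN , v' , u++N∷v'≡Bj) =
    ⊥-elim (≤P⇒≯P (subst (λ w → mediant u ≤P left w) u++N∷v'≡Bj (mediant-≤P-left-++N∷ u v')) lj<m)
  ...   | inj₂ (inj₁ rj≤lu) =
    ⊥-elim (≤P⇒≯P (≤P-trans (right (B j)) (right-nonNull (B j)) m≤rj rj≤lu) (left<mediant u))
  ...   | inj₂ (inj₂ ru≤lj) =
    ⊥-elim (≤P⇒≯P (≤P-trans (right u) (right-nonNull u) (<P⇒≤P (mediant<right u)) ru≤lj) lj<m)

module Endpoints where
  open Matrix
  open import Data.Integer using (+_; _+_; _*_)
  import Data.Integer.Properties as ℤP
  open import Data.Integer.Tactic.RingSolver using (solve-∀)

  toPoint : Pt → Point
  toPoint (a , b) = (+ a , + b)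

  toPoint-injective : ∀ {p q} → toPoint p ≡ toPoint q → p ≡ q
  toPoint-injective refl = refl

  apply : Mat → Point → Point
  apply (mat a b c d) (p , q) = (a * p + b * q , c * p + d * q)

  apply-letterMat : ∀ x p → apply (letterMat x) (toPoint p) ≡ toPoint (act x p)
  apply-letterMat ℓL (p , q) = cong₂ _,_ (unitL (+ p) (+ q)) (trans (unitLN (+ p) (+ q)) (sym (ℤP.pos-+ p q)))
    where
    unitL : ∀ p q → + 1 * p + + 0 * q ≡ p
    unitL = solve-∀
    unitLN : ∀ p q → + 1 * p + + 1 * q ≡ p + q
    unitLN = solve-∀
  apply-letterMat ℓN (p , q) = cong₂ _,_ (trans (unitLN (+ p) (+ q)) (sym (ℤP.pos-+ p q))) (unitN (+ p) (+ q))
    where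
    unitN : ∀ p q → + 0 * p + + 1 * q ≡ q
    unitN = solve-∀
    unitLN : ∀ p q → + 1 * p + + 1 * q ≡ p + q
    unitLN = solve-∀

  apply-e₁ : ∀ M → apply M (+ 1 , + 0) ≡ at∞ M
  apply-e₁ (mat a b c d) = cong₂ _,_ (first a b) (first c d)
    where
    first : ∀ a b → a * + 1 + b * + 0 ≡ a
    first = solve-∀

  apply-e₂ : ∀ M → apply M (+ 0 , + 1) ≡ at0 M
  apply-e₂ (mat a b c d) = cong₂ _,_ (second a b) (second c d)
    where
    second : ∀ a b → a * + 0 + b * + 1 ≡ b
    second = solve-∀

  at0-evalW : ∀ w → at0 (evalW w) ≡ toPoint (left w)
  at0-evalW []      = refl
  at0-evalW (x ∷ w) = trans (cong (apply (letterMat x)) (at0-evalW w)) (apply-letterMat x (left w))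

  at∞-evalW : ∀ w → at∞ (evalW w) ≡ toPoint (right w)
  at∞-evalW []      = refl
  at∞-evalW (x ∷ w) = trans (cong (apply (letterMat x)) (at∞-evalW w)) (apply-letterMat x (right w))

  ≤pt-toPoint : ∀ p q → (toPoint p ≤pt toPoint q) ≡ does (p ≤P? q)
  ≤pt-toPoint (a , b) (c , d) rewrite sym (ℤP.pos-* a d) | sym (ℤP.pos-* c b) = refl

  ends-sorted : ∀ M {p q} → at0 M ≡ toPoint p → at∞ M ≡ toPoint q → p <P q →
                leftEnd M ≡ toPoint p × rightEnd M ≡ toPoint q
  ends-sorted M {p} {q} refl refl p<q
    rewrite ≤pt-toPoint p q | dec-true (p ≤P? q) (<P⇒≤P p<q) = refl , refl

  ends-reversed : ∀ M {p q} → at0 M ≡ toPoint q → at∞ M ≡ toPoint p → p <P q →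
                  leftEnd M ≡ toPoint p × rightEnd M ≡ toPoint q
  ends-reversed M {p} {q} refl refl p<q
    rewrite ≤pt-toPoint q p | dec-false (q ≤P? p) (λ q≤p → ≤P⇒≯P q≤p p<q) = refl , refl

  ends-evalW-Fpow : ∀ w f → leftEnd (evalW w · Fpow f) ≡ toPoint (left w) ×
                            rightEnd (evalW w · Fpow f) ≡ toPoint (right w)
  ends-evalW-Fpow w false = ends-sorted (evalW w · I₂) (trans (apply-e₂ (evalW w)) (at0-evalW w))
                                             (trans (apply-e₁ (evalW w)) (at∞-evalW w)) (left<right w)
  ends-evalW-Fpow w true  = ends-reversed (evalW w · Fmat) (trans (apply-e₁ (evalW w)) (at∞-evalW w))
                                                 (trans (apply-e₂ (evalW w)) (at0-evalW w)) (left<right w)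

module Cosets (T : SlowCF) where
  open SlowCF T
  open Matrix
  open Generation
  open import Data.Integer using (+_; -_)

  InΠ-A : ∀ i → InΠ (A i)
  InΠ-A i = InΠ-· (evalW (B i)) (Fpow (e i)) (InΠ-evalW (B i)) (InΠ-Fpow (e i))

  InΣ-A : ∀ i → InΣ T (A i)
  InΣ-A i = subst (InΣ T) (·-identityʳ (A i)) (mulA i one)

  InΣ-adjA : ∀ i → InΣ T (adj (A i))
  InΣ-adjA i = subst (InΣ T) (·-identityʳ (adj (A i))) (mulInv i one)

  InΣ-· : ∀ {S S'} → InΣ T S → InΣ T S' → InΣ T (S · S')
  InΣ-· {S' = S'} one          h' = subst (InΣ T) (sym (·-identityˡ S')) h'
  InΣ-· {S' = S'} (neg {S} h)  h' = subst (InΣ T) (sym (negM-·ˡ S S')) (neg (InΣ-· h h'))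
  InΣ-· {S' = S'} (mulA {S} i h) h' = subst (InΣ T) (sym (·-assoc (A i) S S')) (mulA i (InΣ-· h h'))
  InΣ-· {S' = S'} (mulInv {S} i h) h' = subst (InΣ T) (sym (·-assoc (adj (A i)) S S')) (mulInv i (InΣ-· h h'))

  HasInverseInΣ : Mat → Set
  HasInverseInΣ S = ∃ λ S' → InΣ T S' × S' · S ≡ I₂

  scalarUnit-hasInverse : ∀ M {X d} → d ≡ + 1 ⊎ d ≡ - + 1 → InΣ T X → X · M ≡ scalar d → HasInverseInΣ M
  scalarUnit-hasInverse M {X} (inj₁ refl) X∈Σ XM≡I  = X , X∈Σ , XM≡I
  scalarUnit-hasInverse M {X} (inj₂ refl) X∈Σ XM≡-I = negM X , neg X∈Σ , trans (negM-·ˡ X M) (cong negM XM≡-I)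

  A-hasInverse : ∀ i → HasInverseInΣ (A i)
  A-hasInverse i = scalarUnit-hasInverse (A i) (InΠ-A i) (InΣ-adjA i) (adj-·ˡ (A i))

  adjA-hasInverse : ∀ i → HasInverseInΣ (adj (A i))
  adjA-hasInverse i = scalarUnit-hasInverse (adj (A i)) (InΠ-A i) (InΣ-A i) (adj-·ʳ (A i))

  inverse-· : ∀ {S X} → HasInverseInΣ S → HasInverseInΣ X → HasInverseInΣ (X · S)
  inverse-· {S} {X} (S' , S'∈Σ , S'S≡I) (X' , X'∈Σ , X'X≡I) = S' · X' , InΣ-· S'∈Σ X'∈Σ , (begin
    (S' · X') · (X · S)  ≡⟨ ·-assoc S' X' (X · S) ⟩
    S' · (X' · (X · S))  ≡⟨ cong (S' ·_) (sym (·-assoc X' X S)) ⟩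
    S' · ((X' · X) · S)  ≡⟨ cong (λ Y → S' · (Y · S)) X'X≡I ⟩
    S' · (I₂ · S)        ≡⟨ cong (S' ·_) (·-identityˡ S) ⟩
    S' · S               ≡⟨ S'S≡I ⟩
    I₂                   ∎)
    where open ≡-Reasoning

  InΣ⇒hasInverse : ∀ {S} → InΣ T S → HasInverseInΣ S
  InΣ⇒hasInverse one = I₂ , one , refl
  InΣ⇒hasInverse (neg {S} h) with InΣ⇒hasInverse h
  ... | S' , S'∈Σ , S'S≡I = negM S' , neg S'∈Σ ,
        trans (negM-·ˡ S' (negM S)) (trans (cong negM (negM-·ʳ S' S)) (trans (negM-involutive (S' · S)) S'S≡I))
  InΣ⇒hasInverse (mulA i h)   = inverse-· (InΣ⇒hasInverse h) (A-hasInverse i)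
  InΣ⇒hasInverse (mulInv i h) = inverse-· (InΣ⇒hasInverse h) (adjA-hasInverse i)

  -- Σ M = Σ M'; unlike _≈coset_ a record, so that M and M' are inferable
  infix 4 _∼_
  record _∼_ (M M' : Mat) : Set where
    constructor ∼by
    field
      S      : Mat
      S∈Σ    : InΣ T S
      M'≡S·M : M' ≡ S · M

  ∼⇒≈coset : ∀ {M M'} → M ∼ M' → _≈coset_ T M M'
  ∼⇒≈coset (∼by S S∈Σ eq) = S , S∈Σ , eq

  ≈coset⇒∼ : ∀ {M M'} → _≈coset_ T M M' → M ∼ M'
  ≈coset⇒∼ (S , S∈Σ , eq) = ∼by S S∈Σ eq

  ≡⇒∼ : ∀ {M M'} → M ≡ M' → M ∼ M'
  ≡⇒∼ {M} refl = ∼by I₂ one (sym (·-identityˡ M))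

  ∼-refl : ∀ {M} → M ∼ M
  ∼-refl = ≡⇒∼ refl

  ∼-sym : ∀ {M M'} → M ∼ M' → M' ∼ M
  ∼-sym {M} (∼by S S∈Σ refl) with InΣ⇒hasInverse S∈Σ
  ... | S' , S'∈Σ , S'S≡I =
    ∼by S' S'∈Σ (sym (trans (sym (·-assoc S' S M)) (trans (cong (_· M) S'S≡I) (·-identityˡ M))))

  ∼-trans : ∀ {M M' M''} → M ∼ M' → M' ∼ M'' → M ∼ M''
  ∼-trans {M} (∼by S S∈Σ refl) (∼by S₂ S₂∈Σ refl) = ∼by (S₂ · S) (InΣ-· S₂∈Σ S∈Σ) (sym (·-assoc S₂ S M))

  ∼-·ʳ : ∀ {M M'} X → M ∼ M' → M · X ∼ M' · X
  ∼-·ʳ {M} X (∼by S S∈Σ refl) = ∼by S S∈Σ (·-assoc S M X)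

  ∼-cancelʳ : ∀ {M M'} X Y → X · Y ≡ I₂ → M · X ∼ M' · X → M ∼ M'
  ∼-cancelʳ {M} {M'} X Y XY≡I MX∼M'X =
    subst₂ _∼_ (·-cancelʳ-inverse M X Y XY≡I) (·-cancelʳ-inverse M' X Y XY≡I) (∼-·ʳ Y MX∼M'X)

  ∼-negM : ∀ {M} → M ∼ negM M
  ∼-negM {M} = ∼by (negM I₂) (neg one) (sym (trans (negM-·ˡ I₂ M) (cong negM (·-identityˡ M))))

  ∼-setoid : Setoid 0ℓ 0ℓ
  ∼-setoid = record
    { Carrier = Mat ; _≈_ = _∼_
    ; isEquivalence = record { refl = ∼-refl ; sym = ∼-sym ; trans = ∼-trans } }

  module ∼-Reasoning = SetoidReasoning ∼-setoid

  module _ {K : ℕ} (rep : Fin K → Mat) where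
    open import Data.Nat.GeneralisedArithmetic using (fold; fold-+)
    import Data.Nat.Properties as ℕ
    open import Data.Nat using (_+_)
    import Data.Fin.Properties as Fin

    -- Pigeonhole: the s-orbit of r is periodic, so the coset of rep r · X⁻¹ lies on it.
    finite-right-inverse : ∀ X Y → X · Y ≡ I₂ → (s : Fin K → Fin K) → (∀ r → rep (s r) ∼ rep r · X) →
                           ∀ r → ∃ λ r' → rep r' ∼ rep r · Y
    finite-right-inverse X Y XY≡I s rep-s r
      with Fin.pigeonhole (ℕ.n<1+n K) (λ t → fold r s (toℕ t))
    ... | i , j , i<j , sⁱr≡sʲr with ℕ.m≤n⇒∃[o]m+o≡n i<j
    ...   | d , i+1+d≡j = fold r s d , (begin
      rep (fold r s d)            ≈⟨ fold-∼ d r ⟩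
      rep r ·Xⁿ d                 ≡⟨ ·-cancelʳ-inverse (rep r ·Xⁿ d) X Y XY≡I ⟨
      ((rep r ·Xⁿ d) · X) · Y     ≈⟨ ∼-·ʳ Y (∼-sym period) ⟩
      rep r · Y                   ∎)
      where
      open ∼-Reasoning
      _·Xⁿ_ : Mat → ℕ → Mat
      M ·Xⁿ m = fold M (_· X) m

      fold-∼ : ∀ m r → rep (fold r s m) ∼ rep r ·Xⁿ m
      fold-∼ zero    r = ∼-refl
      fold-∼ (suc m) r = ∼-trans (rep-s (fold r s m)) (∼-·ʳ X (fold-∼ m r))

      ·Xⁿ-cancel : ∀ m {M M'} → M ·Xⁿ m ∼ M' ·Xⁿ m → M ∼ M'
      ·Xⁿ-cancel zero    h = h
      ·Xⁿ-cancel (suc m) h = ·Xⁿ-cancel m (∼-cancelʳ X Y XY≡I h)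

      period : rep r ∼ (rep r ·Xⁿ d) · X
      period = ·Xⁿ-cancel (toℕ i) (begin
        rep r ·Xⁿ toℕ i              ≈⟨ ∼-sym (fold-∼ (toℕ i) r) ⟩
        rep (fold r s (toℕ i))       ≡⟨ cong rep sⁱr≡sʲr ⟩
        rep (fold r s (toℕ j))       ≈⟨ fold-∼ (toℕ j) r ⟩
        rep r ·Xⁿ toℕ j              ≡⟨ cong (rep r ·Xⁿ_) (trans (sym i+1+d≡j) (sym (ℕ.+-suc (toℕ i) d))) ⟩
        rep r ·Xⁿ (toℕ i + suc d)    ≡⟨ fold-+ (rep r) (_· X) (toℕ i) ⟩
        (rep r ·Xⁿ suc d) ·Xⁿ toℕ i  ∎)

    covers-Π : (∃ λ r → rep r ∼ I₂) →
               (σ : Label → Fin K → Fin K) → (∀ X r → rep (σ X r) ∼ rep r · labelMat X) →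
               ∀ M → InΠ M → ∃ λ r → rep r ∼ M
    covers-Π root σ rep-σ M M∈Π = hit (InΠ⇒Generated M M∈Π)
      where
      step : ∀ {X} → IsGenerator X → ∀ r → ∃ λ r' → rep r' ∼ rep r · X
      step genL   r = σ L r , rep-σ L r
      step genN   r = σ N r , rep-σ N r
      step genF   r = σ F r , rep-σ F r
      step genL⁻¹   = finite-right-inverse Lmat Linv refl (σ L) (rep-σ L)
      step genN⁻¹   = finite-right-inverse Nmat Ninv refl (σ N) (rep-σ N)

      hit : ∀ {M} → Generated M → ∃ λ r → rep r ∼ M
      hit gen-I = root
      hit (gen-· {X = X} g isGen) with hit g
      ... | r , r∼M with step isGen r
      ...   | r' , r'∼rX = r' , ∼-trans r'∼rX (∼-·ʳ X r∼M)
      hit (gen-neg g) with hit g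
      ... | r , r∼M = r , ∼-trans r∼M ∼-negM

module GlueGraph (T : SlowCF) where
  open SlowCF T
  open IsUnimodularPartition part
  open Cosets T
  open Matrix
  open Endpoints
  import Data.Fin as Fin
  import Data.Fin.Properties as Fin
  import Data.Nat as ℕ
  import Data.Nat.Properties as ℕ
  import Data.List.Properties as List

  ends-B : ∀ i → leftEnd (A i) ≡ toPoint (left (B i)) × rightEnd (A i) ≡ toPoint (right (B i))
  ends-B i = ends-evalW-Fpow (B i) (e i)

  open WordPartition n B 2≤n
    (λ i i≡0 → toPoint-injective (trans (sym (proj₁ (ends-B i))) (first i i≡0)))
    (λ i i+1≡n → toPoint-injective (trans (sym (proj₂ (ends-B i))) (last i i+1≡n)))
    (λ i j j≡i+1 → toPoint-injective
       (trans (sym (proj₂ (ends-B i))) (trans (adjacent i j j≡i+1) (proj₁ (ends-B j)))))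

  _~_ : PreV T → PreV T → Set
  _~_ = _~G_ T

  _≟ℓ_ : DecidableEquality Letter
  ℓL ≟ℓ ℓL = yes refl
  ℓL ≟ℓ ℓN = no λ ()
  ℓN ≟ℓ ℓL = no λ ()
  ℓN ≟ℓ ℓN = yes refl

  IsLeaf : List Letter → Set
  IsLeaf u = ∃ λ i → B i ≡ u

  isLeaf? : ∀ u → Dec (IsLeaf u)
  isLeaf? u = Fin.any? λ i → List.≡-dec _≟ℓ_ (B i) u

  -- representative of a ~-class: leaves are replaced by the vertex they are glued to
  normalise : PreV T → PreV T
  normalise (u , f) with isLeaf? u
  ... | yes (i , _) = ([] , f xor e i)
  ... | no _        = (u , f)

  normalise-leaf : ∀ i f → normalise (B i , f) ≡ ([] , f xor e i)
  normalise-leaf i f with isLeaf? (B i)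
  ... | yes (k , Bk≡Bi) = cong (λ j → ([] , f xor e j)) (B-prefix⇒≡ (trans (List.++-identityʳ (B k)) Bk≡Bi))
  ... | no ¬leaf        = contradiction (i , refl) ¬leaf

  normalise-nonLeaf : ∀ {u} f → ¬ IsLeaf u → normalise (u , f) ≡ (u , f)
  normalise-nonLeaf {u} f ¬leaf with isLeaf? u
  ... | yes leaf = contradiction leaf ¬leaf
  ... | no _     = refl

  normalise-root : ∀ f → normalise ([] , f) ≡ ([] , f)
  normalise-root f = normalise-nonLeaf f (λ (i , Bi≡[]) → B-nonempty i Bi≡[])

  ~-normalise : ∀ p → p ~ normalise p
  ~-normalise (u , f) with isLeaf? u
  ... | yes (i , refl) = glue i f
  ... | no _           = ~refl

  ~⇒normalise-≡ : ∀ {p q} → p ~ q → normalise p ≡ normalise q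
  ~⇒normalise-≡ (glue i f)    = trans (normalise-leaf i f) (sym (normalise-root (f xor e i)))
  ~⇒normalise-≡ ~refl         = refl
  ~⇒normalise-≡ (~sym h)      = sym (~⇒normalise-≡ h)
  ~⇒normalise-≡ (~trans h h') = trans (~⇒normalise-≡ h) (~⇒normalise-≡ h')

  normalise-≡⇒~ : ∀ {p q} → normalise p ≡ normalise q → p ~ q
  normalise-≡⇒~ {p} {q} eq = ~trans (~-normalise p) (subst (_~ q) (sym eq) (~sym (~-normalise q)))

  stepLetter : PreV T → Letter → PreV T
  stepLetter (u , f) x = normalise (u ++ [ twist T f x ] , f)

  step : PreV T → Label → PreV T
  step p L       = stepLetter p ℓL
  step p N       = stepLetter p ℓN
  step (u , f) F = normalise (u , not f)

  step-letterLabel : ∀ p x → step p (letterLabel x) ≡ stepLetter p x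
  step-letterLabel p ℓL = refl
  step-letterLabel p ℓN = refl

  normalise-BaseEdge : ∀ {y X t} → BaseEdge T y X t → normalise (proj₁ t) ≡ step (normalise (proj₁ y)) X
  normalise-BaseEdge (treeE {u} {f} {x} {_} {j , v , u++x∷v≡Bj}) =
    sym (trans (cong (λ p → step p (letterLabel x)) (normalise-nonLeaf f u-nonLeaf)) (step-letterLabel (u , f) x))
    where
    u-nonLeaf : ¬ IsLeaf u
    u-nonLeaf (k , refl) = contradiction
      (B-prefixFree (trans (sym (List.++-assoc (B k) [ twist T f x ] v)) u++x∷v≡Bj)) λ ()
  normalise-BaseEdge (flipE {u} {f}) with isLeaf? u
  ... | yes (k , _) = sym (trans (normalise-root (not (f xor e k))) (cong ([] ,_) (not-distribˡ-xor f (e k))))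
  ... | no ¬leaf    = sym (normalise-nonLeaf (not f) ¬leaf)

  Edge : VG T → Label → VG T → Set
  Edge = LGraph.Edge (GT T)

  Edge-unique : ∀ {y X t t'} → Edge y X t → Edge y X t' → proj₁ t ~ proj₁ t'
  Edge-unique {X = X} (y₁ , t₁ , y~y₁ , t~t₁ , b₁) (y₂ , t₂ , y~y₂ , t'~t₂ , b₂) =
    ~trans t~t₁ (~trans (normalise-≡⇒~ (begin
      normalise (proj₁ t₁)          ≡⟨ normalise-BaseEdge b₁ ⟩
      step (normalise (proj₁ y₁)) X ≡⟨ cong (λ p → step p X) (trans (sym (~⇒normalise-≡ y~y₁)) (~⇒normalise-≡ y~y₂)) ⟩
      step (normalise (proj₁ y₂)) X ≡⟨ normalise-BaseEdge b₂ ⟨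
      normalise (proj₁ t₂)          ∎)) (~sym t'~t₂))
    where open ≡-Reasoning

  treeEdge : ∀ {u z v i} f x → u ++ z ∷ v ≡ B i → (pu : ∃ λ k → IsPrefix u (B k)) →
             ∃ λ t → BaseEdge T ((u , f) , pu) (letterLabel x) t
  treeEdge {u} f x u++z∷v≡Bi pu with extend u++z∷v≡Bi (twist T f x)
  ... | j , v' , u++x∷v'≡Bj =
    ((u ++ [ twist T f x ] , f) , j , v' , trans (List.++-assoc u [ twist T f x ] v') u++x∷v'≡Bj) , treeE

  B-uncons : ∀ i → ∃₂ λ z w → z ∷ w ≡ B i
  B-uncons i with B i | B-nonempty i
  ... | []    | Bi≢[] = contradiction refl Bi≢[]
  ... | z ∷ w | _     = z , w , refl

  letterEdge : ∀ y x → ∃ λ t → Edge y (letterLabel x) t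
  letterEdge y@((u , f) , i , z ∷ v , u++z∷v≡Bi) x with treeEdge f x u++z∷v≡Bi (i , z ∷ v , u++z∷v≡Bi)
  ... | t , y→t = t , y , t , ~refl , ~refl , y→t
  letterEdge ((u , f) , i , [] , u++[]≡Bi) x with B-uncons i
  ... | z , w , z∷w≡Bi with treeEdge (f xor e i) x z∷w≡Bi (i , B i , refl)
  ...   | t , root→t = t , (([] , f xor e i) , i , B i , refl) , t , y~root , ~refl , root→t
    where
    y~root : (u , f) ~ ([] , f xor e i)
    y~root = subst (λ w → (w , f) ~ ([] , f xor e i)) (trans (sym u++[]≡Bi) (List.++-identityʳ u)) (glue i f)

  outEdge : ∀ y X → ∃ λ t → Edge y X t
  outEdge y@((u , f) , pu) F = t , y , t , ~refl , ~refl , flipE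
    where
    t : VG T
    t = ((u , not f) , pu)
  outEdge y L = letterEdge y ℓL
  outEdge y N = letterEdge y ℓN

  φP : PreV T → Mat
  φP (u , f) = evalW u · Fpow f

  φ : VG T → Σ Mat InΠ
  φ ((u , f) , _) = φP (u , f) , InΠ-· (evalW u) (Fpow f) (InΠ-evalW u) (InΠ-Fpow f)

  Fpow-twist : ∀ f x → Fpow f · letterMat x ≡ letterMat (twist T f x) · Fpow f
  Fpow-twist false ℓL = refl
  Fpow-twist false ℓN = refl
  Fpow-twist true  ℓL = refl
  Fpow-twist true  ℓN = refl

  labelMat-letterLabel : ∀ x → labelMat (letterLabel x) ≡ letterMat x
  labelMat-letterLabel ℓL = refl
  labelMat-letterLabel ℓN = refl

  φP-BaseEdge : ∀ {y X t} → BaseEdge T y X t → φP (proj₁ y) · labelMat X ≡ φP (proj₁ t)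
  φP-BaseEdge (treeE {u} {f} {x}) = begin
    (evalW u · Fpow f) · labelMat (letterLabel x)    ≡⟨ cong ((evalW u · Fpow f) ·_) (labelMat-letterLabel x) ⟩
    (evalW u · Fpow f) · letterMat x                 ≡⟨ ·-assoc (evalW u) (Fpow f) (letterMat x) ⟩
    evalW u · (Fpow f · letterMat x)                 ≡⟨ cong (evalW u ·_) (Fpow-twist f x) ⟩
    evalW u · (letterMat (twist T f x) · Fpow f)     ≡⟨ ·-assoc (evalW u) (letterMat (twist T f x)) (Fpow f) ⟨
    (evalW u · letterMat (twist T f x)) · Fpow f     ≡⟨ cong (_· Fpow f) (evalW-∷ʳ u (twist T f x)) ⟨
    evalW (u ++ [ twist T f x ]) · Fpow f            ∎
    where open ≡-Reasoning
  φP-BaseEdge (flipE {u} {f}) = trans (·-assoc (evalW u) (Fpow f) Fmat) (cong (evalW u ·_) (Fpow-· f true))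

  φP-glue : ∀ i f → φP ([] , f xor e i) ∼ φP (B i , f)
  φP-glue i f = ∼by (A i) (InΣ-A i) (sym (begin
    A i · (I₂ · Fpow (f xor e i))                        ≡⟨ cong (A i ·_) (·-identityˡ (Fpow (f xor e i))) ⟩
    (evalW (B i) · Fpow (e i)) · Fpow (f xor e i)        ≡⟨ ·-assoc (evalW (B i)) (Fpow (e i)) (Fpow (f xor e i)) ⟩
    evalW (B i) · (Fpow (e i) · Fpow (f xor e i))        ≡⟨ cong (evalW (B i) ·_) (Fpow-·-xor (e i) f) ⟩
    evalW (B i) · Fpow f                                 ∎))
    where open ≡-Reasoning

  φP-cong : ∀ {p q} → p ~ q → φP p ∼ φP q
  φP-cong (glue i f)    = ∼-sym (φP-glue i f)
  φP-cong ~refl         = ∼-refl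
  φP-cong (~sym h)      = ∼-sym (φP-cong h)
  φP-cong (~trans h h') = ∼-trans (φP-cong h) (φP-cong h')

  φP-Edge : ∀ {y X t} → Edge y X t → φP (proj₁ t) ∼ φP (proj₁ y) · labelMat X
  φP-Edge {X = X} (y' , t' , y~y' , t~t' , y'→t') =
    ∼-trans (φP-cong t~t') (∼-trans (≡⇒∼ (sym (φP-BaseEdge y'→t'))) (∼-·ʳ (labelMat X) (∼-sym (φP-cong y~y'))))

  -- any bound on the lengths of the B i would do
  totalLength : ∀ m → (Fin m → List Letter) → ℕ
  totalLength zero    W = 0
  totalLength (suc m) W = length (W Fin.zero) ℕ.+ totalLength m (λ i → W (Fin.suc i))

  length≤totalLength : ∀ m W i → length (W i) ≤ totalLength m W
  length≤totalLength (suc m) W Fin.zero    = ℕ.m≤m+n _ _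
  length≤totalLength (suc m) W (Fin.suc i) = ℕ.≤-trans (length≤totalLength m (λ i → W (Fin.suc i)) i) (ℕ.m≤n+m _ _)

  Sz K : ℕ
  Sz = suc (totalLength n B)
  K  = n ℕ.* (Sz ℕ.* 2)

  vertexAt : Fin n → Fin Sz → Fin 2 → VG T
  vertexAt i m b =
    (take (toℕ m) (B i) , Inverse.to Fin.2↔Bool b) , i , drop (toℕ m) (B i) , List.take++drop≡id (toℕ m) (B i)

  decode : Fin K → VG T
  decode r = uncurry (λ i c → uncurry (vertexAt i) (Fin.remQuot 2 c)) (Fin.remQuot (Sz ℕ.* 2) r)

  length<Sz : ∀ u v i → u ++ v ≡ B i → length u < Sz
  length<Sz u v i u++v≡Bi =
    s≤s (ℕ.≤-trans (subst (λ w → length u ≤ length w) u++v≡Bi (List.length-++-≤ˡ u)) (length≤totalLength n B i))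

  code : VG T → Fin K
  code ((u , f) , i , v , u++v≡Bi) =
    Fin.combine i (Fin.combine (fromℕ< (length<Sz u v i u++v≡Bi)) (Inverse.from Fin.2↔Bool f))

  take-length-++ : ∀ (u v : List Letter) → take (length u) (u ++ v) ≡ u
  take-length-++ []      v = refl
  take-length-++ (x ∷ u) v = cong (x ∷_) (take-length-++ u v)

  decode-code : ∀ t → proj₁ (decode (code t)) ≡ proj₁ t
  decode-code ((u , f) , i , v , u++v≡Bi) = begin
    proj₁ (decode (Fin.combine i (Fin.combine m b)))
      ≡⟨ cong (λ (i , c) → proj₁ (uncurry (vertexAt i) (Fin.remQuot 2 c))) (Fin.remQuot-combine i (Fin.combine m b)) ⟩
    proj₁ (uncurry (vertexAt i) (Fin.remQuot 2 (Fin.combine m b)))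
      ≡⟨ cong (λ (m , b) → proj₁ (vertexAt i m b)) (Fin.remQuot-combine m b) ⟩
    (take (toℕ m) (B i) , Inverse.to Fin.2↔Bool b)
      ≡⟨ cong₂ _,_ prefix (Inverse.strictlyInverseˡ Fin.2↔Bool f) ⟩
    (u , f) ∎
    where
    open ≡-Reasoning
    m : Fin Sz
    m = fromℕ< (length<Sz u v i u++v≡Bi)
    b : Fin 2
    b = Inverse.from Fin.2↔Bool f
    prefix : take (toℕ m) (B i) ≡ u
    prefix = trans (cong₂ take (Fin.toℕ-fromℕ< (length<Sz u v i u++v≡Bi)) (sym u++v≡Bi)) (take-length-++ u v)

  rep : Fin K → Mat
  rep r = φP (proj₁ (decode r))

  successor : Label → Fin K → Fin K
  successor X r = code (proj₁ (outEdge (decode r) X))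

  rep-successor : ∀ X r → rep (successor X r) ∼ rep r · labelMat X
  rep-successor X r =
    ∼-trans (≡⇒∼ (cong φP (decode-code t))) (φP-Edge {decode r} {X} {t} (proj₂ (outEdge (decode r) X)))
    where
    t : VG T
    t = proj₁ (outEdge (decode r) X)

  cosetRep : ∀ M → InΠ M → ∃ λ r → rep r ∼ M
  cosetRep = covers-Π rep (code (rootG T) , ≡⇒∼ (cong φP (decode-code (rootG T)))) successor rep-successor

  vertexOver : ∀ M → InΠ M → ∃ λ y → φP (proj₁ y) ∼ M
  vertexOver M M∈Π = let (r , r∼M) = cosetRep M M∈Π in decode r , r∼M

  edgeOver : ∀ y X {M} → M ∼ φP (proj₁ y) · labelMat X → ∃ λ t → Edge y X t × φP (proj₁ t) ∼ M
  edgeOver y X M∼yX = let (t , y→t) = outEdge y X in t , y→t , ∼-trans (φP-Edge {y} {X} {t} y→t) (∼-sym M∼yX)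

  opfibration : Opfibration (GT T) (Schreier T)
  opfibration = record
    { φ          = φ
    ; φ-cong     = λ y≈y' → ∼⇒≈coset (φP-cong y≈y')
    ; φ-root     = ∼⇒≈coset ∼-refl
    ; φ-edge     = λ {y} {X} {t} y→t → ∼⇒≈coset (φP-Edge {y} {X} {t} y→t)
    ; surj-V     = λ (M , M∈Π) → let (y , y∼M) = vertexOver M M∈Π in y , ∼⇒≈coset y∼M
    ; surj-E     = λ {(M , M∈Π)} {X} M'≈MX →
        let (y , y∼M)         = vertexOver M M∈Π
            (t , y→t , t∼M') = edgeOver y X (∼-trans (≈coset⇒∼ M'≈MX) (∼-·ʳ (labelMat X) (∼-sym y∼M)))
        in y , t , y→t , ∼⇒≈coset y∼M , ∼⇒≈coset t∼M'
    ; local-inj  = λ {y} {X} {t} {t'} y→t y→t' _ → Edge-unique {y} {X} {t} {t'} y→t y→t'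
    ; local-surj = λ {y} {X} M≈yX →
        let (t , y→t , t∼M) = edgeOver y X (≈coset⇒∼ M≈yX) in t , y→t , ∼⇒≈coset t∼M
    }

  finiteIndex : FiniteIndex T
  finiteIndex = K , (λ r → φ (decode r)) , λ (M , M∈Π) →
    let (r , r∼M) = cosetRep M M∈Π in r , ∼⇒≈coset (∼-sym r∼M)

theorem3p2 : (T : SlowCF) → Opfibration (GT T) (Schreier T) × FiniteIndex T
theorem3p2 T = GlueGraph.opfibration T , GlueGraph.finiteIndex T
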